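{- Let $\ell\ge 2$ and $m\ge 1$ be integers. For integers $s,r\geq 2$, with $F=\left\lfloor \frac{\sqrt{1+8(r-1)(s-1)}-1}{2}\right\rfloor+r+s$, \begin{align*} \log_\ell F\leq\operatorname{PR}_{\mathcal{Q}(\ell)}^2(\vee_r,\wedge_s)\leq\left\lceil\log_{(\ell+1)/2}(r+s-1)\right\rceil \quad\text{and}\quad F^{1/m}\leq \operatorname{PR}_{\mathcal{H}(m)}^2(\vee_r,\wedge_s)\leq \left\lceil 2(r+s-1)^{1/m}\right\rceil-1. \end{align*}
   Context: $[\ell]^m$ denotes the grid poset of $m$-tuples with entries in $\{1,\dots,\ell\}$, ordered coordinatewise. $\mathcal{Q}(\ell)=\{Q_n(\ell):n\ge1\}$ with $Q_n(\ell)=[\ell]^n$, and $\mathcal{H}(m)=\{H_n(m):n\ge1\}$ with $H_n(m)=[n]^m$. The $r$-cup $\vee_r$ is the 2-uniform pograph on $\{x,y_1,\dots,y_r\}$ with $x\le y_i$ and edges $xy_i$; the $s$-cap $\wedge_s$ is the pograph on $\{y,x_1,\dots,x_s\}$ with $x_i\le y$ and edges $x_iy$. Given a coloring of the comparable pairs of a poset $Q$, a copy of $H$ in color $i$ is an injection $f:V(H)\to Q$ with $f(x)\le f(y)$ whenever $x\le y$ such that every edge of $H$ is mapped to a pair of color $i$. For a family $\mathcal{P}=\{P_n\}$, $\operatorname{PR}_{\mathcal{P}}^2(G_1,G_2)$ is the least $N$ such that every 2-coloring of the comparable pairs of $P_N$ contains a copy of $G_1$ in color 1 or of $G_2$ in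 color 2. -}

module Defs where

open import Data.Nat using (ℕ; zero; suc; _≤_; _<_)
open import Data.Fin using (Fin; zero; suc)
import Data.Fin as F
open import Data.Vec using (Vec; lookup)
open import Data.Product using (Σ; _×_)
open import Data.Sum using (_⊎_)
open import Relation.Binary.PropositionalEquality using (_≡_; _≢_)
open import Relation.Nullary using (¬_)
open import Function.Definitions using (Injective)

-- The grid poset [ℓ]^m : m-tuples with entries in an ℓ-element chain
-- (Fin ℓ, i.e. {0,…,ℓ-1} ≅ {1,…,ℓ}), ordered coordinatewise.
Grid : ℕ → ℕ → Set
Grid ℓ m = Vec (Fin ℓ) m

_≼_ : ∀ {ℓ m} → Grid ℓ m → Grid ℓ m → Set
_≼_ {m = m} a b = (i : Fin m) → lookup a i F.≤ lookup b i

-- Colours are Fin 2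
-- (zero = colour 1, suc zero = colour 2).  It is given as a function on
-- all ordered pairs; only its values on comparable pairs (a ≼ b, a ≠ b)
-- are ever inspected, so this is the same as a colouring of comparable pairs.
Colouring : ℕ → ℕ → Set
Colouring ℓ m = Grid ℓ m → Grid ℓ m → Fin 2

CupCopy : ∀ {ℓ m} → Colouring ℓ m → Fin 2 → ℕ → Set
CupCopy {ℓ} {m} c col r =
  Σ (Grid ℓ m) λ x → Σ (Fin r → Grid ℓ m) λ y →
    Injective _≡_ _≡_ y ×
    ((i : Fin r) → (x ≢ y i) × (x ≼ y i) × (c x (y i) ≡ col))

CapCopy : ∀ {ℓ m} → Colouring ℓ m → Fin 2 → ℕ → Set
CapCopy {ℓ} {m} c col s =
  Σ (Grid ℓ m) λ y → Σ (Fin s → Grid ℓ m) λ x →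
    Injective _≡_ _≡_ x ×
    ((i : Fin s) → (x i ≢ y) × (x i ≼ y) × (c (x i) y ≡ col))

Arrows : ℕ → ℕ → ℕ → ℕ → Set
Arrows ℓ m r s =
  (c : Colouring ℓ m) → CupCopy c zero r ⊎ CapCopy c (suc zero) s

IsPR : (ℕ → Set) → ℕ → Set
IsPR A N = (1 ≤ N) × A N × ((M : ℕ) → 1 ≤ M → M < N → ¬ A M)

-- Upper bounds by double counting: [ℓ]^d has (ℓ(ℓ+1)/2)^d comparable pairs v ≼ w.  If a 2-colouring has
-- no red r-cup and no blue s-cap, every point has at most r - 1 red pairs above it (the top point none),
-- at most s - 1 blue pairs below it and one equal pair, so there are fewer than ℓ^d (r + s - 1) comparable
-- pairs; hence (r + s - 1) 2^d ≤ (ℓ + 1)^d forces a red cup or a blue cap.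
-- Lower bounds: with c = r - 1, a = s - 1 and k(k+1)/2 ≤ c a, a chain of k + r + s - 1 elements can be
-- coloured so that every element has at most c red pairs above it and at most a blue pairs below it;
-- pulled back along a linear extension of [ℓ]^d, it has no red r-cup and no blue s-cap once ℓ^d < k + r + s.
-- Arrowing is decidable, as there are finitely many colourings, so the least arrowing size exists as
-- soon as one size is known to arrow.

module Submission where

open import Defs
open import Data.Nat
open import Data.Nat.Properties
open import Data.Nat.DivMod
open import Data.Nat.Tactic.RingSolver using (solve-∀)
open import Data.Empty using (⊥; ⊥-elim)
open import Data.Unit using (⊤; tt)
open import Data.Fin as F using (Fin; zero; suc; toℕ)
import Data.Fin.Properties as FinP
open import Data.Vec as Vec using (Vec; []; _∷_; lookup; tabulate)
import Data.Vec.Properties as VecP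
open import Data.List as List using (List; []; _∷_; _++_; map; length; allFin; cartesianProductWith; cartesianProduct)
open import Data.List.Properties using (length-tabulate)
open import Data.List.Membership.Propositional using (_∈_; find; lose)
open import Data.List.Membership.Propositional.Properties using (∈-cartesianProductWith⁺; ∈-cartesianProduct⁺; ∈-allFin)
open import Data.List.Relation.Unary.Any as Any using (here; there)
open import Data.List.Relation.Unary.All as All using ([]; _∷_)
open import Data.List.Relation.Unary.AllPairs using ([]; _∷_)
open import Data.List.Relation.Unary.Unique.Propositional using (Unique)
import Data.List.Relation.Unary.Unique.Propositional.Properties as UniqueP
open import Data.Product using (Σ; ∃; _×_; _,_; proj₁; proj₂; curry; uncurry)
import Data.Product.Properties as ProdP
open import Data.Sum using (_⊎_; inj₁; inj₂)
open import Function using (_∘_; case_of_)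
open import Function.Definitions using (Injective)
open import Relation.Nullary using (¬_; Dec; yes; no; contradiction)
open import Relation.Nullary.Decidable using (_×-dec_; _⊎-dec_; _→-dec_; ¬?; toWitness)
open import Relation.Binary.Definitions using (DecidableEquality; tri<; tri≈; tri>)
open import Relation.Binary.PropositionalEquality hiding ([_])

private variable
  A B : Set

∑ : (A → ℕ) → List A → ℕ
∑ f []       = 0
∑ f (x ∷ xs) = f x + ∑ f xs

indicator : {P : Set} → Dec P → ℕ
indicator (yes _) = 1
indicator (no _)  = 0

indicator-yes : {P : Set} (p? : Dec P) → P → indicator p? ≡ 1
indicator-yes (yes _) _ = refl
indicator-yes (no ¬p) p = contradiction p ¬p

indicator-no : {P : Set} (p? : Dec P) → ¬ P → indicator p? ≡ 0
indicator-no (yes p) ¬p = contradiction p ¬p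
indicator-no (no _)  _  = refl

indicator-cong : {P Q : Set} (p? : Dec P) (q? : Dec Q) → (P → Q) → (Q → P) → indicator p? ≡ indicator q?
indicator-cong (yes p) q? to _    = sym (indicator-yes q? (to p))
indicator-cong (no ¬p) q? _  from = sym (indicator-no q? (¬p ∘ from))

indicator-× : {P Q : Set} (p? : Dec P) (q? : Dec Q) → indicator (p? ×-dec q?) ≡ indicator p? * indicator q?
indicator-× (yes _) (yes _) = refl
indicator-× (yes _) (no _)  = refl
indicator-× (no _)  _       = refl

∑-cong : {f g : A → ℕ} (xs : List A) → (∀ x → f x ≡ g x) → ∑ f xs ≡ ∑ g xs
∑-cong []       _   = refl
∑-cong (x ∷ xs) f≗g = cong₂ _+_ (f≗g x) (∑-cong xs f≗g)

∑-mono-≤ : {f g : A → ℕ} (xs : List A) → (∀ x → f x ≤ g x) → ∑ f xs ≤ ∑ g xs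
∑-mono-≤ []       _   = z≤n
∑-mono-≤ (x ∷ xs) f≤g = +-mono-≤ (f≤g x) (∑-mono-≤ xs f≤g)

∑-const : (k : ℕ) (xs : List A) → ∑ (λ _ → k) xs ≡ length xs * k
∑-const k []       = refl
∑-const k (x ∷ xs) = cong (k +_) (∑-const k xs)

∑-length : (xs : List A) → ∑ (λ _ → 1) xs ≡ length xs
∑-length []       = refl
∑-length (x ∷ xs) = cong suc (∑-length xs)

∑-≤-const : {f : A → ℕ} {k : ℕ} (xs : List A) → (∀ x → f x ≤ k) → ∑ f xs ≤ length xs * k
∑-≤-const {k = k} xs f≤k = ≤-trans (∑-mono-≤ xs f≤k) (≤-reflexive (∑-const k xs))

∑-distrib-+ : (f g : A → ℕ) (xs : List A) → ∑ (λ x → f x + g x) xs ≡ ∑ f xs + ∑ g xs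
∑-distrib-+ f g []       = refl
∑-distrib-+ f g (x ∷ xs) = trans (cong (f x + g x +_) (∑-distrib-+ f g xs)) (+-interchange (f x) (g x) _ _)
  where
  +-interchange : ∀ a b c d → a + b + (c + d) ≡ a + c + (b + d)
  +-interchange = solve-∀

∑-distribˡ-* : (k : ℕ) (f : A → ℕ) (xs : List A) → ∑ (λ x → k * f x) xs ≡ k * ∑ f xs
∑-distribˡ-* k f []       = sym (*-zeroʳ k)
∑-distribˡ-* k f (x ∷ xs) = trans (cong (k * f x +_) (∑-distribˡ-* k f xs)) (sym (*-distribˡ-+ k (f x) _))

∑-distribʳ-* : (k : ℕ) (f : A → ℕ) (xs : List A) → ∑ (λ x → f x * k) xs ≡ ∑ f xs * k
∑-distribʳ-* k f xs = trans (∑-cong xs (λ x → *-comm (f x) k)) (trans (∑-distribˡ-* k f xs) (*-comm k _))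

∑-comm : (f : A → B → ℕ) (xs : List A) (ys : List B) →
         ∑ (λ x → ∑ (f x) ys) xs ≡ ∑ (λ y → ∑ (λ x → f x y) xs) ys
∑-comm f []       ys = sym (trans (∑-const 0 ys) (*-zeroʳ (length ys)))
∑-comm f (x ∷ xs) ys = trans (cong (∑ (f x) ys +_) (∑-comm f xs ys)) (sym (∑-distrib-+ (f x) _ ys))

∑-++ : (f : A → ℕ) (xs ys : List A) → ∑ f (xs ++ ys) ≡ ∑ f xs + ∑ f ys
∑-++ f []       ys = refl
∑-++ f (x ∷ xs) ys = trans (cong (f x +_) (∑-++ f xs ys)) (sym (+-assoc (f x) _ _))

∑-map : (f : B → ℕ) (g : A → B) (xs : List A) → ∑ f (map g xs) ≡ ∑ (f ∘ g) xs
∑-map f g []       = refl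
∑-map f g (x ∷ xs) = cong (f (g x) +_) (∑-map f g xs)

∑-cartesianProductWith : {C : Set} (f : C → ℕ) (h : A → B → C) (xs : List A) (ys : List B) →
                         ∑ f (cartesianProductWith h xs ys) ≡ ∑ (λ x → ∑ (λ y → f (h x y)) ys) xs
∑-cartesianProductWith f h []       ys = refl
∑-cartesianProductWith f h (x ∷ xs) ys =
  trans (∑-++ f (map (h x) ys) _) (cong₂ _+_ (∑-map f (h x) ys) (∑-cartesianProductWith f h xs ys))

∑-tabulate : ∀ {n} (f : B → ℕ) (g : Fin n → B) → ∑ f (List.tabulate g) ≡ ∑ (f ∘ g) (allFin n)
∑-tabulate {n = zero}  f g = refl
∑-tabulate {n = suc n} f g =
  cong (f (g zero) +_) (trans (∑-tabulate f (g ∘ suc)) (sym (∑-tabulate (f ∘ g) suc)))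

∑-≤-const-with-zero : {f : A → ℕ} {k : ℕ} {z : A} (xs : List A) →
                      (∀ x → f x ≤ k) → z ∈ xs → f z ≡ 0 → ∑ f xs + k ≤ length xs * k
∑-≤-const-with-zero {f = f} {k} (x ∷ xs) f≤k (here refl) fz≡0 = begin
  f x + ∑ f xs + k ≡⟨ cong (λ v → v + ∑ f xs + k) fz≡0 ⟩
  ∑ f xs + k       ≡⟨ +-comm (∑ f xs) k ⟩
  k + ∑ f xs       ≤⟨ +-monoʳ-≤ k (∑-≤-const xs f≤k) ⟩
  k + length xs * k ∎
  where open ≤-Reasoning
∑-≤-const-with-zero {f = f} {k} (x ∷ xs) f≤k (there z∈xs) fz≡0 = begin
  f x + ∑ f xs + k   ≡⟨ +-assoc (f x) _ k ⟩
  f x + (∑ f xs + k) ≤⟨ +-mono-≤ (f≤k x) (∑-≤-const-with-zero xs f≤k z∈xs fz≡0) ⟩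
  k + length xs * k  ∎
  where open ≤-Reasoning

∑∑-separable : (f : A → A → ℕ) (g : B → B → ℕ) (xs : List A) (ys : List B) →
  ∑ (λ x → ∑ (λ y → ∑ (λ x′ → ∑ (λ y′ → f x x′ * g y y′) ys) xs) ys) xs ≡
  ∑ (λ x → ∑ (f x) xs) xs * ∑ (λ y → ∑ (g y) ys) ys
∑∑-separable f g xs ys = begin
  ∑ (λ x → ∑ (λ y → ∑ (λ x′ → ∑ (λ y′ → f x x′ * g y y′) ys) xs) ys) xs
    ≡⟨ ∑-cong xs (λ x → ∑-cong ys (λ y → ∑-cong xs (λ x′ → ∑-distribˡ-* (f x x′) (g y) ys))) ⟩
  ∑ (λ x → ∑ (λ y → ∑ (λ x′ → f x x′ * G y) xs) ys) xs
    ≡⟨ ∑-cong xs (λ x → ∑-cong ys (λ y → ∑-distribʳ-* (G y) (f x) xs)) ⟩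
  ∑ (λ x → ∑ (λ y → F x * G y) ys) xs
    ≡⟨ ∑-cong xs (λ x → ∑-distribˡ-* (F x) G ys) ⟩
  ∑ (λ x → F x * ∑ G ys) xs
    ≡⟨ ∑-distribʳ-* (∑ G ys) F xs ⟩
  ∑ F xs * ∑ G ys ∎
  where
  open ≡-Reasoning
  F = λ x → ∑ (f x) xs
  G = λ y → ∑ (g y) ys

distinct-witnesses : {P : A → Set} (P? : ∀ x → Dec (P x)) (xs : List A) → Unique xs →
                     ∀ m → m ≤ ∑ (indicator ∘ P?) xs →
                     Σ (Fin m → A) λ y → Injective _≡_ _≡_ y × (∀ i → P (y i) × y i ∈ xs)
distinct-witnesses P? xs       _            zero    _ = (λ ()) , (λ {i} → λ {}) , λ ()
distinct-witnesses P? (x ∷ xs) (x∉xs ∷ !xs) (suc m) m<∑ with P? x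
... | no _ =
  let y , y-inj , y∈ = distinct-witnesses P? xs !xs (suc m) m<∑
  in y , y-inj , λ i → proj₁ (y∈ i) , there (proj₂ (y∈ i))
... | yes px =
  let y , y-inj , y∈ = distinct-witnesses P? xs !xs m (s≤s⁻¹ m<∑)
      y′ : Fin (suc m) → _
      y′ = λ { zero → x ; (suc i) → y i }
      y′-inj : Injective _≡_ _≡_ y′
      y′-inj = λ { {zero} {zero} _ → refl
                 ; {zero} {suc j} x≡yj → contradiction x≡yj (All.lookup x∉xs (proj₂ (y∈ j)))
                 ; {suc i} {zero} yi≡x → contradiction (sym yi≡x) (All.lookup x∉xs (proj₂ (y∈ i)))
                 ; {suc i} {suc j} yi≡yj → cong suc (y-inj yi≡yj) }
  in y′ , y′-inj , λ { zero → px , here refl ; (suc i) → proj₁ (y∈ i) , there (proj₂ (y∈ i)) }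

-- Enumerating grids; arrowing is decidable

vecsOf : List A → (n : ℕ) → List (Vec A n)
vecsOf xs zero    = [] ∷ []
vecsOf xs (suc n) = cartesianProductWith _∷_ xs (vecsOf xs n)

∈-vecsOf : {xs : List A} → (∀ x → x ∈ xs) → ∀ {n} (v : Vec A n) → v ∈ vecsOf xs n
∈-vecsOf ∈xs []      = here refl
∈-vecsOf ∈xs (x ∷ v) = ∈-cartesianProductWith⁺ _∷_ (∈xs x) (∈-vecsOf ∈xs v)

vecsOf-unique : {xs : List A} → Unique xs → ∀ n → Unique (vecsOf xs n)
vecsOf-unique !xs zero    = [] ∷ []
vecsOf-unique !xs (suc n) = UniqueP.cartesianProductWith⁺ _∷_ VecP.∷-injective !xs (vecsOf-unique !xs n)

length-vecsOf : (xs : List A) (n : ℕ) → length (vecsOf xs n) ≡ length xs ^ n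
length-vecsOf xs zero    = refl
length-vecsOf xs (suc n) = begin
  length (vecsOf xs (suc n))             ≡⟨ ∑-length (vecsOf xs (suc n)) ⟨
  ∑ (λ _ → 1) (vecsOf xs (suc n))        ≡⟨ ∑-cartesianProductWith (λ _ → 1) Vec._∷_ xs (vecsOf xs n) ⟩
  ∑ (λ _ → ∑ (λ _ → 1) (vecsOf xs n)) xs ≡⟨ ∑-const _ xs ⟩
  length xs * ∑ (λ _ → 1) (vecsOf xs n)  ≡⟨ cong (length xs *_) (∑-length (vecsOf xs n)) ⟩
  length xs * length (vecsOf xs n)       ≡⟨ cong (length xs *_) (length-vecsOf xs n) ⟩
  length xs * length xs ^ n              ∎
  where open ≡-Reasoning

grids : ∀ ℓ d → List (Grid ℓ d)
grids ℓ d = vecsOf (allFin ℓ) d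

∈-grids : ∀ {ℓ d} (v : Grid ℓ d) → v ∈ grids ℓ d
∈-grids = ∈-vecsOf ∈-allFin

grids-unique : ∀ ℓ d → Unique (grids ℓ d)
grids-unique ℓ = vecsOf-unique (UniqueP.allFin⁺ ℓ)

length-grids : ∀ ℓ d → length (grids ℓ d) ≡ ℓ ^ d
length-grids ℓ d = trans (length-vecsOf (allFin ℓ) d) (cong (_^ d) (length-tabulate (λ i → i)))

_≟ᵍ_ : ∀ {ℓ d} → DecidableEquality (Grid ℓ d)
_≟ᵍ_ = VecP.≡-dec FinP._≟_

_≼?_ : ∀ {ℓ d} (x y : Grid ℓ d) → Dec (x ≼ y)
x ≼? y = FinP.all? (λ i → lookup x i F.≤? lookup y i)

∃-dec : {P : A → Set} (xs : List A) → (∀ x → x ∈ xs) → (∀ x → Dec (P x)) → Dec (∃ P)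
∃-dec xs ∈xs P? with Any.any? P? xs
... | yes p∈ = let x , _ , px = find p∈ in yes (x , px)
... | no ¬p∈ = no λ (x , px) → ¬p∈ (lose (∈xs x) px)

Extensional : {X : Set} → ((X → A) → Set) → Set
Extensional P = ∀ {f g} → (∀ x → f x ≡ g x) → P f → P g

∃-tuple-dec : ∀ {n} {P : (Fin n → A) → Set} (xs : List A) → (∀ x → x ∈ xs) →
              (∀ f → Dec (P f)) → Extensional P → Dec (Σ (Fin n → A) P)
∃-tuple-dec {n = n} xs ∈xs P? ext with ∃-dec (vecsOf xs n) (∈-vecsOf ∈xs) (P? ∘ lookup)
... | yes (v , pv) = yes (lookup v , pv)
... | no ¬pv      = no λ (f , pf) → ¬pv (tabulate f , ext (λ i → sym (VecP.lookup∘tabulate f i)) pf)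

module _ {A B : Set} (_≟_ : DecidableEquality A) {bs : List B} (∈bs : ∀ b → b ∈ bs) (b₀ : B) where

  private
    override : A → B → (A → B) → A → B
    override a b f x with x ≟ a
    ... | yes _ = b
    ... | no _  = f x

    functionsOn : List A → List (A → B)
    functionsOn []       = (λ _ → b₀) ∷ []
    functionsOn (a ∷ as) = cartesianProductWith (override a) bs (functionsOn as)

    functionsOn-complete : ∀ as (g : A → B) → Σ (A → B) λ f → f ∈ functionsOn as × (∀ {x} → x ∈ as → f x ≡ g x)
    functionsOn-complete []       g = (λ _ → b₀) , here refl , λ ()
    functionsOn-complete (a ∷ as) g =
      let f , f∈ , f≗g = functionsOn-complete as g
      in override a (g a) f , ∈-cartesianProductWith⁺ (override a) (∈bs (g a)) f∈ , agree f f≗g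
      where
      agree : ∀ f → (∀ {x} → x ∈ as → f x ≡ g x) → ∀ {x} → x ∈ a ∷ as → override a (g a) f x ≡ g x
      agree f f≗g {x} x∈ with x ≟ a
      agree f f≗g (here refl)  | yes _ = refl
      agree f f≗g (there x∈as) | yes refl = refl
      agree f f≗g (here refl)  | no x≢a = contradiction refl x≢a
      agree f f≗g (there x∈as) | no _ = f≗g x∈as

  ∀-function-dec : {P : (A → B) → Set} (as : List A) → (∀ x → x ∈ as) →
                   (∀ f → Dec (P f)) → Extensional P → Dec (∀ f → P f)
  ∀-function-dec as ∈as P? ext with All.all? P? (functionsOn as)
  ... | yes all = yes λ g → let f , f∈ , f≗g = functionsOn-complete as g in ext (λ x → f≗g (∈as x)) (All.lookup all f∈)
  ... | no ¬all = no λ ∀P → ¬all (All.tabulate (λ {f} _ → ∀P f))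

injective? : ∀ {n} → DecidableEquality A → (f : Fin n → A) → Dec (Injective _≡_ _≡_ f)
injective? _≟_ f with FinP.all? (λ i → FinP.all? (λ j → (f i ≟ f j) →-dec (i FinP.≟ j)))
... | yes inj = yes λ {i} {j} → inj i j
... | no ¬inj = no λ inj → ¬inj (λ i j → inj)

star-dec : ∀ {r} {Q : A → A → Set} (xs : List A) → (∀ x → x ∈ xs) → DecidableEquality A → (∀ x y → Dec (Q x y)) →
           Dec (Σ A λ x → Σ (Fin r → A) λ y → Injective _≡_ _≡_ y × (∀ i → Q x (y i)))
star-dec {Q = Q} xs ∈xs _≟_ Q? = ∃-dec xs ∈xs λ x →
  ∃-tuple-dec xs ∈xs (λ y → injective? _≟_ y ×-dec FinP.all? (λ i → Q? x (y i)))
    (λ y≗y′ (inj , q) → (λ {i} {j} y′i≡y′j → inj (trans (y≗y′ i) (trans y′i≡y′j (sym (y≗y′ j))))) ,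
                         λ i → subst (Q x) (y≗y′ i) (q i))

cup-dec : ∀ {ℓ d} (c : Colouring ℓ d) col r → Dec (CupCopy c col r)
cup-dec c col r = star-dec (grids _ _) ∈-grids _≟ᵍ_ λ x y → ¬? (x ≟ᵍ y) ×-dec x ≼? y ×-dec c x y FinP.≟ col

cap-dec : ∀ {ℓ d} (c : Colouring ℓ d) col s → Dec (CapCopy c col s)
cap-dec c col s = star-dec (grids _ _) ∈-grids _≟ᵍ_ λ y x → ¬? (x ≟ᵍ y) ×-dec x ≼? y ×-dec c x y FinP.≟ col

arrows-dec : ∀ ℓ d r s → Dec (Arrows ℓ d r s)
arrows-dec ℓ d r s with ∀-function-dec (ProdP.≡-dec _≟ᵍ_ _≟ᵍ_) ∈-allFin zero
                          (cartesianProduct (grids ℓ d) (grids ℓ d))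
                          (λ (x , y) → ∈-cartesianProduct⁺ (∈-grids x) (∈-grids y))
                          (λ c → cup-dec (curry c) zero r ⊎-dec cap-dec (curry c) (suc zero) s)
                          respects
  where
  respects : Extensional (λ c → CupCopy (curry c) zero r ⊎ CapCopy (curry c) (suc zero) s)
  respects c≗c′ (inj₁ (x , y , inj , h)) =
    inj₁ (x , y , inj , λ i → let x≢ , x≼ , red = h i in x≢ , x≼ , trans (sym (c≗c′ (x , y i))) red)
  respects c≗c′ (inj₂ (y , x , inj , h)) =
    inj₂ (y , x , inj , λ i → let x≢ , x≼ , blue = h i in x≢ , x≼ , trans (sym (c≗c′ (x i , y))) blue)
... | yes arrows = yes λ c → arrows (uncurry c)
... | no ¬arrows = no λ arrows → ¬arrows (arrows ∘ curry)

-- Counting comparable pairs: the upper bound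

chainPairs : ℕ → ℕ
chainPairs ℓ = ∑ (λ a → ∑ (λ b → indicator (a F.≤? b)) (allFin ℓ)) (allFin ℓ)

comparablePairs : ℕ → ℕ → ℕ
comparablePairs ℓ d = ∑ (λ v → ∑ (λ w → indicator (v ≼? w)) (grids ℓ d)) (grids ℓ d)

chainPairs-suc : ∀ ℓ → chainPairs (suc ℓ) ≡ suc ℓ + chainPairs ℓ
chainPairs-suc ℓ = cong₂ _+_ fromZero fromSuc
  where
  open ≡-Reasoning
  fromZero : ∑ (λ b → indicator (F.zero {ℓ} F.≤? b)) (allFin (suc ℓ)) ≡ suc ℓ
  fromZero = begin
    ∑ (λ b → indicator (F.zero {ℓ} F.≤? b)) (allFin (suc ℓ))
      ≡⟨ ∑-cong (allFin (suc ℓ)) (λ b → indicator-yes (F.zero {ℓ} F.≤? b) z≤n) ⟩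
    ∑ (λ _ → 1) (allFin (suc ℓ)) ≡⟨ ∑-length (allFin (suc ℓ)) ⟩
    length (allFin (suc ℓ))      ≡⟨ length-tabulate (λ i → i) ⟩
    suc ℓ                        ∎
  fromSuc : ∑ (λ a → ∑ (λ b → indicator (a F.≤? b)) (allFin (suc ℓ))) (List.tabulate {n = ℓ} F.suc)
            ≡ chainPairs ℓ
  fromSuc = begin
    ∑ (λ a → ∑ (λ b → indicator (a F.≤? b)) (allFin (suc ℓ))) (List.tabulate {n = ℓ} F.suc)
      ≡⟨ ∑-tabulate {n = ℓ} (λ a → ∑ (λ b → indicator (a F.≤? b)) (allFin (suc ℓ))) F.suc ⟩
    ∑ (λ a → indicator (F.suc a F.≤? F.zero {ℓ})
             + ∑ (λ b → indicator (F.suc a F.≤? b)) (List.tabulate {n = ℓ} F.suc)) (allFin ℓ)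
      ≡⟨ ∑-cong (allFin ℓ) (λ a → cong₂ _+_ (indicator-no (F.suc a F.≤? F.zero {ℓ}) λ ())
                                             (∑-tabulate {n = ℓ} (λ b → indicator (F.suc a F.≤? b)) F.suc)) ⟩
    ∑ (λ a → ∑ (λ b → indicator (F.suc a F.≤? F.suc b)) (allFin ℓ)) (allFin ℓ)
      ≡⟨ ∑-cong (allFin ℓ) (λ a → ∑-cong (allFin ℓ) (λ b →
           indicator-cong (F.suc a F.≤? F.suc b) (a F.≤? b) s≤s⁻¹ s≤s)) ⟩
    chainPairs ℓ ∎

2*chainPairs : ∀ ℓ → 2 * chainPairs ℓ ≡ ℓ * suc ℓ
2*chainPairs zero    = refl
2*chainPairs (suc ℓ) = begin
  2 * chainPairs (suc ℓ)       ≡⟨ cong (2 *_) (chainPairs-suc ℓ) ⟩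
  2 * (suc ℓ + chainPairs ℓ)   ≡⟨ *-distribˡ-+ 2 (suc ℓ) (chainPairs ℓ) ⟩
  2 * suc ℓ + 2 * chainPairs ℓ ≡⟨ cong (2 * suc ℓ +_) (2*chainPairs ℓ) ⟩
  2 * suc ℓ + ℓ * suc ℓ        ≡⟨ *-distribʳ-+ (suc ℓ) 2 ℓ ⟨
  (2 + ℓ) * suc ℓ              ≡⟨ *-comm (2 + ℓ) (suc ℓ) ⟩
  suc ℓ * suc (suc ℓ)          ∎
  where open ≡-Reasoning

∷-≼-indicator : ∀ {ℓ d} (a b : Fin ℓ) (v w : Grid ℓ d) →
                indicator ((a ∷ v) ≼? (b ∷ w)) ≡ indicator (a F.≤? b) * indicator (v ≼? w)
∷-≼-indicator a b v w = trans
  (indicator-cong ((a ∷ v) ≼? (b ∷ w)) (a F.≤? b ×-dec v ≼? w)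
     (λ a∷v≼b∷w → a∷v≼b∷w zero , a∷v≼b∷w ∘ suc)
     (λ { (a≤b , v≼w) zero → a≤b ; (a≤b , v≼w) (suc i) → v≼w i }))
  (indicator-× (a F.≤? b) (v ≼? w))

comparablePairs-suc : ∀ ℓ d → comparablePairs ℓ (suc d) ≡ chainPairs ℓ * comparablePairs ℓ d
comparablePairs-suc ℓ d = begin
  comparablePairs ℓ (suc d)
    ≡⟨ ∑-cartesianProductWith _ Vec._∷_ (allFin ℓ) G ⟩
  ∑ (λ a → ∑ (λ v → ∑ (λ w → indicator ((a ∷ v) ≼? w)) (grids ℓ (suc d))) G) (allFin ℓ)
    ≡⟨ ∑-cong (allFin ℓ) (λ a → ∑-cong G (λ v → ∑-cartesianProductWith _ Vec._∷_ (allFin ℓ) G)) ⟩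
  ∑ (λ a → ∑ (λ v → ∑ (λ b → ∑ (λ w → indicator ((a ∷ v) ≼? (b ∷ w))) G) (allFin ℓ)) G) (allFin ℓ)
    ≡⟨ ∑-cong (allFin ℓ) (λ a → ∑-cong G (λ v → ∑-cong (allFin ℓ) (λ b → ∑-cong G (∷-≼-indicator a b v)))) ⟩
  ∑ (λ a → ∑ (λ v → ∑ (λ b → ∑ (λ w → indicator (a F.≤? b) * indicator (v ≼? w)) G) (allFin ℓ)) G) (allFin ℓ)
    ≡⟨ ∑∑-separable (λ a b → indicator (a F.≤? b)) (λ v w → indicator (v ≼? w)) (allFin ℓ) G ⟩
  chainPairs ℓ * comparablePairs ℓ d ∎
  where
  open ≡-Reasoning
  G = grids ℓ d

2^d*comparablePairs : ∀ ℓ d → 2 ^ d * comparablePairs ℓ d ≡ ℓ ^ d * suc ℓ ^ d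
2^d*comparablePairs ℓ zero    = refl
2^d*comparablePairs ℓ (suc d) = begin
  2 * 2 ^ d * comparablePairs ℓ (suc d)               ≡⟨ cong (2 * 2 ^ d *_) (comparablePairs-suc ℓ d) ⟩
  2 * 2 ^ d * (chainPairs ℓ * comparablePairs ℓ d)    ≡⟨ regroup (2 ^ d) (chainPairs ℓ) (comparablePairs ℓ d) ⟩
  (2 * chainPairs ℓ) * (2 ^ d * comparablePairs ℓ d)  ≡⟨ cong₂ _*_ (2*chainPairs ℓ) (2^d*comparablePairs ℓ d) ⟩
  ℓ * suc ℓ * (ℓ ^ d * suc ℓ ^ d)                     ≡⟨ *-*-interchange ℓ (suc ℓ) (ℓ ^ d) (suc ℓ ^ d) ⟩
  ℓ * ℓ ^ d * (suc ℓ * suc ℓ ^ d)                     ∎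
  where
  open ≡-Reasoning
  regroup : ∀ x y z → 2 * x * (y * z) ≡ (2 * y) * (x * z)
  regroup = solve-∀
  *-*-interchange : ∀ w x y z → w * x * (y * z) ≡ w * y * (x * z)
  *-*-interchange = solve-∀

topGrid : ∀ ℓ d → Grid (suc ℓ) d
topGrid ℓ d = Vec.replicate d (F.fromℕ ℓ)

topGrid-maximal : ∀ {ℓ d} (w : Grid (suc ℓ) d) → topGrid ℓ d ≼ w → w ≡ topGrid ℓ d
topGrid-maximal []      _     = refl
topGrid-maximal (x ∷ w) top≼w =
  cong₂ _∷_ (FinP.≤-antisym (FinP.≤fromℕ x) (top≼w zero)) (topGrid-maximal w (top≼w ∘ suc))

module NoMonochromaticStars {ℓ d ρ σ : ℕ} (c : Colouring (suc ℓ) d)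
         (no-cup : ¬ CupCopy c zero (suc ρ)) (no-cap : ¬ CapCopy c (suc zero) (suc σ)) where

  private
    G = grids (suc ℓ) d

    Coloured : Fin 2 → Grid (suc ℓ) d → Grid (suc ℓ) d → Set
    Coloured col v w = v ≢ w × v ≼ w × c v w ≡ col

    coloured? : ∀ col v w → Dec (Coloured col v w)
    coloured? col v w = ¬? (v ≟ᵍ w) ×-dec v ≼? w ×-dec c v w FinP.≟ col

    red blue : Grid (suc ℓ) d → Grid (suc ℓ) d → ℕ
    red  v w = indicator (coloured? zero v w)
    blue v w = indicator (coloured? (suc zero) v w)

    same : Grid (suc ℓ) d → Grid (suc ℓ) d → ℕ
    same v w = indicator (v ≟ᵍ w)

    comparable-split : ∀ v w → indicator (v ≼? w) ≤ same v w + red v w + blue v w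
    comparable-split v w with v ≼? w | v ≟ᵍ w | c v w
    ... | no _  | _     | _          = z≤n
    ... | yes _ | yes _ | _          = s≤s z≤n
    ... | yes _ | no _  | zero       = s≤s z≤n
    ... | yes _ | no _  | suc zero   = s≤s z≤n

    red-out : ∀ v → ∑ (red v) G ≤ ρ
    red-out v = ≮⇒≥ λ ρ<out →
      let y , y-inj , y∈ = distinct-witnesses (coloured? zero v) G (grids-unique _ d) (suc ρ) ρ<out
      in no-cup (v , y , y-inj , proj₁ ∘ y∈)

    blue-in : ∀ w → ∑ (λ v → blue v w) G ≤ σ
    blue-in w = ≮⇒≥ λ σ<in →
      let x , x-inj , x∈ = distinct-witnesses (λ v → coloured? (suc zero) v w) G (grids-unique _ d) (suc σ) σ<in
      in no-cap (w , x , x-inj , proj₁ ∘ x∈)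

    same-once : ∀ v → ∑ (same v) G ≤ 1
    same-once v = ≮⇒≥ λ 1<same →
      let y , y-inj , y∈ = distinct-witnesses (v ≟ᵍ_) G (grids-unique _ d) 2 1<same
      in contradiction (y-inj (trans (sym (proj₁ (y∈ zero))) (proj₁ (y∈ (suc zero))))) λ ()

    no-red-out-of-top : ∑ (red (topGrid ℓ d)) G ≡ 0
    no-red-out-of-top = trans (∑-cong G λ w → indicator-no (coloured? zero _ w)
                                 λ (top≢w , top≼w , _) → top≢w (sym (topGrid-maximal w top≼w)))
                              (trans (∑-const 0 G) (*-zeroʳ (length G)))

  comparablePairs-bound : comparablePairs (suc ℓ) d + ρ ≤ suc ℓ ^ d * (1 + ρ + σ)
  comparablePairs-bound = begin
    comparablePairs (suc ℓ) d + ρ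
      ≤⟨ +-monoˡ-≤ ρ (∑-mono-≤ G λ v → ∑-mono-≤ G (comparable-split v)) ⟩
    ∑ (λ v → ∑ (λ w → same v w + red v w + blue v w) G) G + ρ
      ≡⟨ cong (_+ ρ) (∑-cong G λ v → trans (∑-distrib-+ (λ w → same v w + red v w) (blue v) G)
                                           (cong (_+ ∑ (blue v) G) (∑-distrib-+ (same v) (red v) G))) ⟩
    ∑ (λ v → ∑ (same v) G + ∑ (red v) G + ∑ (blue v) G) G + ρ
      ≡⟨ cong (_+ ρ) (trans (∑-distrib-+ (λ v → ∑ (same v) G + ∑ (red v) G) (λ v → ∑ (blue v) G) G)
                            (cong (_+ ∑ (λ v → ∑ (blue v) G) G)
                                  (∑-distrib-+ (λ v → ∑ (same v) G) (λ v → ∑ (red v) G) G))) ⟩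
    sames + reds + ∑ (λ v → ∑ (blue v) G) G + ρ
      ≡⟨ cong (λ b → sames + reds + b + ρ) (∑-comm blue G G) ⟩
    sames + reds + blues + ρ
      ≡⟨ +-rearrange sames reds blues ρ ⟩
    sames + (reds + ρ) + blues
      ≤⟨ +-mono-≤ (+-mono-≤ (∑-≤-const G same-once)
                            (∑-≤-const-with-zero G red-out (∈-grids (topGrid ℓ d)) no-red-out-of-top))
                  (∑-≤-const G blue-in) ⟩
    length G * 1 + length G * ρ + length G * σ
      ≡⟨ cong (λ n → n * 1 + n * ρ + n * σ) (length-grids (suc ℓ) d) ⟩
    suc ℓ ^ d * 1 + suc ℓ ^ d * ρ + suc ℓ ^ d * σ
      ≡⟨ factor (suc ℓ ^ d) ρ σ ⟩
    suc ℓ ^ d * (1 + ρ + σ) ∎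
    where
    open ≤-Reasoning
    sames = ∑ (λ v → ∑ (same v) G) G
    reds  = ∑ (λ v → ∑ (red v) G) G
    blues = ∑ (λ w → ∑ (λ v → blue v w) G) G
    +-rearrange : ∀ a b c e → a + b + c + e ≡ a + (b + e) + c
    +-rearrange = solve-∀
    factor : ∀ n ρ σ → n * 1 + n * ρ + n * σ ≡ n * (1 + ρ + σ)
    factor = solve-∀

arrows-by-counting : ∀ {ℓ} d r s → 1 ≤ ℓ → 2 ≤ r → 1 ≤ s → (r + s ∸ 1) * 2 ^ d ≤ suc ℓ ^ d → Arrows ℓ d r s
arrows-by-counting {suc ℓ} d r@(suc (suc ρ)) s@(suc σ) (s≤s z≤n) (s≤s (s≤s z≤n)) (s≤s z≤n) small c
  with cup-dec c zero r | cap-dec c (suc zero) s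
... | yes cup   | _         = inj₁ cup
... | no _      | yes cap   = inj₂ cap
... | no no-cup | no no-cap = contradiction (≤-trans fewer more) (m+1+n≰m (comparablePairs (suc ℓ) d))
  where
  n = suc ℓ ^ d
  fewer : comparablePairs (suc ℓ) d + suc ρ ≤ n * (r + s ∸ 1)
  fewer = subst (λ X → comparablePairs (suc ℓ) d + suc ρ ≤ n * X) (sym (+-suc (suc ρ) σ))
                (NoMonochromaticStars.comparablePairs-bound c no-cup no-cap)
  more : n * (r + s ∸ 1) ≤ comparablePairs (suc ℓ) d
  more = *-cancelˡ-≤ (2 ^ d) {{m^n≢0 2 d}} (begin
    2 ^ d * (n * (r + s ∸ 1))   ≡⟨ *-comm (2 ^ d) _ ⟩
    n * (r + s ∸ 1) * 2 ^ d     ≡⟨ *-assoc n _ (2 ^ d) ⟩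
    n * ((r + s ∸ 1) * 2 ^ d)   ≤⟨ *-monoʳ-≤ n small ⟩
    n * suc (suc ℓ) ^ d         ≡⟨ 2^d*comparablePairs (suc ℓ) d ⟨
    2 ^ d * comparablePairs (suc ℓ) d ∎)
    where open ≤-Reasoning

-- Colouring a chain: the lower bound

triangle : ℕ → ℕ
triangle zero    = 0
triangle (suc q) = triangle q + q

triangle-mono-≤ : ∀ {m n} → m ≤ n → triangle m ≤ triangle n
triangle-mono-≤ {zero}              _         = z≤n
triangle-mono-≤ {suc m} {suc n} (s≤s m≤n) = +-mono-≤ (triangle-mono-≤ m≤n) m≤n

2*triangle : ∀ k → 2 * triangle (suc k) ≡ k * (k + 1)
2*triangle zero    = refl
2*triangle (suc k) = begin
  2 * (triangle (suc k) + suc k)   ≡⟨ *-distribˡ-+ 2 (triangle (suc k)) (suc k) ⟩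
  2 * triangle (suc k) + 2 * suc k ≡⟨ cong (_+ 2 * suc k) (2*triangle k) ⟩
  k * (k + 1) + 2 * suc k          ≡⟨ expand k ⟩
  suc k * (suc k + 1)              ∎
  where
  open ≡-Reasoning
  expand : ∀ k → k * (k + 1) + 2 * suc k ≡ suc k * (suc k + 1)
  expand = solve-∀

-- The pairs p < q are numbered lexicographically by (q , p), starting from 0.
pairIndex : ℕ → ℕ → ℕ
pairIndex p q = triangle q + p

pairIndex<triangle : ∀ {p q} → p < q → pairIndex p q < triangle (suc q)
pairIndex<triangle {q = q} = +-monoʳ-< (triangle q)

pairIndex-<-later : ∀ {p q p′ q′} → p < q → q < q′ → pairIndex p q < pairIndex p′ q′
pairIndex-<-later {p′ = p′} p<q q<q′ =
  <-≤-trans (pairIndex<triangle p<q) (≤-trans (triangle-mono-≤ q<q′) (m≤m+n _ p′))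

pairIndex-injective : ∀ {p q p′ q′} → p < q → p′ < q′ → pairIndex p q ≡ pairIndex p′ q′ → p ≡ p′ × q ≡ q′
pairIndex-injective {p} {q} {p′} {q′} p<q p′<q′ same with <-cmp q q′
... | tri< q<q′ _ _ = contradiction same (<⇒≢ (pairIndex-<-later p<q q<q′))
... | tri> _ _ q′<q = contradiction (sym same) (<⇒≢ (pairIndex-<-later p′<q′ q′<q))
... | tri≈ _ refl _ = +-cancelˡ-≡ (triangle q) p p′ same , refl

module _ (a : ℕ) .{{_ : NonZero a}} where

  divmod-injective : ∀ {u v} → u % a ≡ v % a → u / a ≡ v / a → u ≡ v
  divmod-injective {u} {v} u%≡v% u/≡v/ = begin
    u                   ≡⟨ m≡m%n+[m/n]*n u a ⟩
    u % a + u / a * a   ≡⟨ cong₂ (λ r q → r + q * a) u%≡v% u/≡v/ ⟩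
    v % a + v / a * a   ≡⟨ m≡m%n+[m/n]*n v a ⟨
    v                   ∎
    where open ≡-Reasoning

  /-mono-gap : ∀ {u v} → u + a ≤ v → u / a < v / a
  /-mono-gap {u} {v} u+a≤v = begin-strict
    u / a             <⟨ n<1+n (u / a) ⟩
    1 + u / a         ≡⟨ cong (λ w → 1 + w / a) (m+n∸n≡m u a) ⟨
    1 + (u + a ∸ a) / a ≡⟨ m/n≡1+[m∸n]/n (m≤n+m a u) ⟨
    (u + a) / a       ≤⟨ /-monoˡ-≤ a u+a≤v ⟩
    v / a             ∎
    where open ≤-Reasoning

  %-injective-window : ∀ {u v} → u < v → v < u + a → u % a ≢ v % a
  %-injective-window {u} {v} u<v v<u+a u%≡v% with <-cmp (u / a) (v / a)
  ... | tri≈ _ u/≡v/ _ = <⇒≢ u<v (divmod-injective u%≡v% u/≡v/)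
  ... | tri> _ _ v/<u/ = <⇒≱ v/<u/ (/-monoˡ-≤ a (<⇒≤ u<v))
  ... | tri< u/<v/ _ _ = <⇒≱ v<u+a (begin
    u + a                   ≡⟨ cong (_+ a) (m≡m%n+[m/n]*n u a) ⟩
    u % a + u / a * a + a   ≡⟨ +-assoc (u % a) _ a ⟩
    u % a + (u / a * a + a) ≡⟨ cong (u % a +_) (+-comm _ a) ⟩
    u % a + suc (u / a) * a ≤⟨ +-mono-≤ (≤-reflexive u%≡v%) (*-monoˡ-≤ a u/<v/) ⟩
    v % a + v / a * a       ≡⟨ m≡m%n+[m/n]*n v a ⟨
    v                       ∎)
    where open ≤-Reasoning

data Vertex : Set where
  low mid high : ℕ → Vertex

data Label : Set where
  red blue : ℕ → Label

-- The chain low 0 < … < low (a - 1) < mid 0 < … < mid k < high 0 < … < high (c - 1), with edges u < w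
-- coloured red with a label below c or blue with a label below a; the labels of the red edges leaving a
-- vertex, and of the blue edges entering it, will be distinct.  By default low–low and low–mid edges are
-- blue with the label of their source, low–high, mid–high and high–high edges red with the label of their
-- target.  Each middle pair p < q owns the slot (b , t) = (i % a , i / a) of its index i = pairIndex p q,
-- and i < c * a by the hypothesis on k.  If q ≤ a, then mid p → mid q is blue with label b, while
-- low b → mid q turns red with label t and low b → high t blue.  If q > a, then mid p → mid q is red
-- with label t, while mid p → high t turns blue with label b.  The indices of the pairs entering a fixed
-- q ≤ a lie in a window shorter than a, and those leaving a fixed p towards q > a are more than a apart.
module ChainColouring (a c k : ℕ) .{{_ : NonZero a}} (room : k * (k + 1) ≤ 2 * (c * a)) where

  Valid : Vertex → Set
  Valid (low b)  = b < a
  Valid (mid x)  = x ≤ k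
  Valid (high t) = t < c

  _⋖_ : Vertex → Vertex → Set
  low b  ⋖ low b′  = b < b′
  low _  ⋖ mid _   = ⊤
  low _  ⋖ high _  = ⊤
  mid p  ⋖ mid q   = p < q
  mid _  ⋖ high _  = ⊤
  high t ⋖ high t′ = t < t′
  _      ⋖ _       = ⊥

  residueSlot? : ∀ b q → Dec (∃ λ (p : Fin q) → q ≤ a × pairIndex (toℕ p) q % a ≡ b)
  residueSlot? b q = FinP.any? λ p → q ≤? a ×-dec pairIndex (toℕ p) q % a ≟ b

  quotientSlot? : ∀ p t → Dec (∃ λ (q : Fin (suc k)) → a < toℕ q × p < toℕ q × pairIndex p (toℕ q) / a ≡ t)
  quotientSlot? p t = FinP.any? λ q → a <? toℕ q ×-dec p <? toℕ q ×-dec pairIndex p (toℕ q) / a ≟ t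

  lowMid : ℕ → ℕ → Label
  lowMid b q with residueSlot? b q
  ... | yes (p , _) = red (pairIndex (toℕ p) q / a)
  ... | no _        = blue b

  -- The indices of the pairs with q ≤ a lie below triangle (suc a), those with q > a above.
  lowHigh : ℕ → ℕ → Label
  lowHigh b t with b + t * a <? triangle (suc a)
  ... | yes _ = blue b
  ... | no _  = red t

  midMid : ℕ → ℕ → Label
  midMid p q with q ≤? a
  ... | yes _ = blue (pairIndex p q % a)
  ... | no _  = red (pairIndex p q / a)

  midHigh : ℕ → ℕ → Label
  midHigh p t with quotientSlot? p t
  ... | yes (q , _) = blue (pairIndex p (toℕ q) % a)
  ... | no _        = red t

  colour : Vertex → Vertex → Label
  colour (low b)  (low _)  = blue b
  colour (low b)  (mid q)  = lowMid b q
  colour (low b)  (high t) = lowHigh b t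
  colour (mid p)  (mid q)  = midMid p q
  colour (mid p)  (high t) = midHigh p t
  colour (high _) (high t) = red t
  colour _        _        = red 0  -- downward pairs, never used

  lowMid-red : ∀ {b q t} → lowMid b q ≡ red t →
               ∃ λ p → p < q × q ≤ a × pairIndex p q % a ≡ b × pairIndex p q / a ≡ t
  lowMid-red {b} {q} eq with residueSlot? b q
  lowMid-red {b} {q} refl | yes (p , q≤a , p%≡b) = toℕ p , FinP.toℕ<n p , q≤a , p%≡b , refl

  lowMid-blue : ∀ {b q u} → lowMid b q ≡ blue u → u ≡ b × (q ≤ a → ∀ p → p < q → pairIndex p q % a ≢ b)
  lowMid-blue {b} {q} eq with residueSlot? b q
  lowMid-blue {b} {q} refl | no none = refl , λ q≤a p p<q p%≡b →
    none (F.fromℕ< p<q , q≤a , subst (λ p → pairIndex p q % a ≡ b) (sym (FinP.toℕ-fromℕ< p<q)) p%≡b)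

  lowHigh-red : ∀ {b t u} → lowHigh b t ≡ red u → u ≡ t × triangle (suc a) ≤ b + t * a
  lowHigh-red {b} {t} eq with b + t * a <? triangle (suc a)
  lowHigh-red {b} {t} refl | no ≮ = refl , ≮⇒≥ ≮

  lowHigh-blue : ∀ {b t u} → lowHigh b t ≡ blue u → u ≡ b × b + t * a < triangle (suc a)
  lowHigh-blue {b} {t} eq with b + t * a <? triangle (suc a)
  lowHigh-blue {b} {t} refl | yes below = refl , below

  midMid-red : ∀ {p q t} → midMid p q ≡ red t → a < q × pairIndex p q / a ≡ t
  midMid-red {p} {q} eq with q ≤? a
  midMid-red {p} {q} refl | no q≰a = ≰⇒> q≰a , refl

  midMid-blue : ∀ {p q u} → midMid p q ≡ blue u → q ≤ a × pairIndex p q % a ≡ u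
  midMid-blue {p} {q} eq with q ≤? a
  midMid-blue {p} {q} refl | yes q≤a = q≤a , refl

  midHigh-red : ∀ {p t u} → midHigh p t ≡ red u →
                u ≡ t × (∀ q → q ≤ k → a < q → p < q → pairIndex p q / a ≢ t)
  midHigh-red {p} {t} eq with quotientSlot? p t
  midHigh-red {p} {t} refl | no none = refl , λ q q≤k a<q p<q q/≡t →
    none (F.fromℕ< (s≤s q≤k) ,
          subst (λ q → a < q × p < q × pairIndex p q / a ≡ t) (sym (FinP.toℕ-fromℕ< (s≤s q≤k))) (a<q , p<q , q/≡t))

  midHigh-blue : ∀ {p t u} → midHigh p t ≡ blue u →
                 ∃ λ q → q ≤ k × a < q × p < q × pairIndex p q / a ≡ t × pairIndex p q % a ≡ u
  midHigh-blue {p} {t} eq with quotientSlot? p t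
  midHigh-blue {p} {t} refl | yes (q , a<q , p<q , q/≡t) = toℕ q , s≤s⁻¹ (FinP.toℕ<n q) , a<q , p<q , q/≡t , refl

  private
    slot-recompose : ∀ {g b t} → g % a ≡ b → g / a ≡ t → b + t * a ≡ g
    slot-recompose {g} refl refl = sym (m≡m%n+[m/n]*n g a)

    blue-pair-below : ∀ {p q} → p < q → q ≤ a → pairIndex p q < triangle (suc a)
    blue-pair-below p<q q≤a = <-≤-trans (pairIndex<triangle p<q) (triangle-mono-≤ (s≤s q≤a))

    red-pair-above : ∀ {p q} → a < q → triangle (suc a) ≤ pairIndex p q
    red-pair-above {p} a<q = ≤-trans (triangle-mono-≤ a<q) (m≤m+n _ p)

    mid-pair-quotient< : ∀ {p q} → p < q → q ≤ k → pairIndex p q / a < c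
    mid-pair-quotient< {p} {q} p<q q≤k = m<n*o⇒m/o<n (begin-strict
      pairIndex p q    <⟨ pairIndex<triangle p<q ⟩
      triangle (suc q) ≤⟨ triangle-mono-≤ (s≤s q≤k) ⟩
      triangle (suc k) ≤⟨ *-cancelˡ-≤ 2 (subst (_≤ 2 * (c * a)) (sym (2*triangle k)) room) ⟩
      c * a            ∎)
      where open ≤-Reasoning

    red-pair-quotients-increase : ∀ {p q q′} → a < q → q < q′ → pairIndex p q / a < pairIndex p q′ / a
    red-pair-quotients-increase {p} {q} {q′} a<q q<q′ = /-mono-gap a (begin
      triangle q + p + a   ≡⟨ +-assoc (triangle q) p a ⟩
      triangle q + (p + a) ≡⟨ cong (triangle q +_) (+-comm p a) ⟩
      triangle q + (a + p) ≡⟨ +-assoc (triangle q) a p ⟨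
      triangle q + a + p ≤⟨ +-monoˡ-≤ p (+-monoʳ-≤ (triangle q) (<⇒≤ a<q)) ⟩
      triangle (suc q) + p ≤⟨ +-monoˡ-≤ p (triangle-mono-≤ q<q′) ⟩
      triangle q′ + p ∎)
      where open ≤-Reasoning

    blue-pair-residues-distinct : ∀ {p p′ q} → q ≤ a → p < p′ → p′ < q → pairIndex p q % a ≢ pairIndex p′ q % a
    blue-pair-residues-distinct {p} {p′} {q} q≤a p<p′ p′<q = %-injective-window a (+-monoʳ-< (triangle q) p<p′) (begin-strict
      triangle q + p′       <⟨ +-monoʳ-< (triangle q) (<-≤-trans p′<q q≤a) ⟩
      triangle q + a        ≤⟨ +-monoʳ-≤ (triangle q) (m≤n+m a p) ⟩
      triangle q + (p + a)  ≡⟨ +-assoc (triangle q) p a ⟨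
      triangle q + p + a    ∎)
      where open ≤-Reasoning

    lowMid-lowHigh-red-clash : ∀ {b x t t′} → lowMid b x ≡ red t → lowHigh b t′ ≡ red t → ⊥
    lowMid-lowHigh-red-clash e e′ with lowMid-red e | lowHigh-red e′
    ... | p , p<x , x≤a , p%≡b , p/≡t | refl , above =
      <⇒≱ (subst (_< triangle (suc a)) (sym (slot-recompose p%≡b p/≡t)) (blue-pair-below p<x x≤a)) above

    midMid-midHigh-red-clash : ∀ {p q t t′} → p < q → q ≤ k → midMid p q ≡ red t → midHigh p t′ ≡ red t → ⊥
    midMid-midHigh-red-clash p<q q≤k e e′ with midMid-red e | midHigh-red e′
    ... | a<q , q/≡t | refl , none = none _ q≤k a<q p<q q/≡t

    lowMid-midMid-blue-clash : ∀ {b p x t} → p < x → lowMid b x ≡ blue t → midMid p x ≡ blue t → ⊥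
    lowMid-midMid-blue-clash p<x e e′ with lowMid-blue e | midMid-blue e′
    ... | refl , none | x≤a , p%≡t = none x≤a _ p<x p%≡t

    lowHigh-midHigh-blue-clash : ∀ {b x t u} → lowHigh b t ≡ blue u → midHigh x t ≡ blue u → ⊥
    lowHigh-midHigh-blue-clash e e′ with lowHigh-blue e | midHigh-blue e′
    ... | refl , below | q , _ , a<q , _ , q/≡t , q%≡b =
      <⇒≱ below (subst (triangle (suc a) ≤_) (sym (slot-recompose q%≡b q/≡t)) (red-pair-above a<q))

  red-out-injective : ∀ u w w′ {t} → u ⋖ w → u ⋖ w′ → Valid w → Valid w′ →
                      colour u w ≡ red t → colour u w′ ≡ red t → w ≡ w′
  red-out-injective (low b) (mid x) (mid x′) _ _ _ _ e e′ with lowMid-red e | lowMid-red e′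
  ... | p , p<x , _ , p%≡b , p/≡t | p′ , p′<x′ , _ , p′%≡b , p′/≡t =
    cong mid (proj₂ (pairIndex-injective p<x p′<x′
      (divmod-injective a (trans p%≡b (sym p′%≡b)) (trans p/≡t (sym p′/≡t)))))
  red-out-injective (low b) (mid x) (high t′) _ _ _ _ e e′ = ⊥-elim (lowMid-lowHigh-red-clash e e′)
  red-out-injective (low b) (high t′) (mid x) _ _ _ _ e e′ = ⊥-elim (lowMid-lowHigh-red-clash e′ e)
  red-out-injective (low b) (high t₁) (high t₂) _ _ _ _ e e′ =
    cong high (trans (sym (proj₁ (lowHigh-red e))) (proj₁ (lowHigh-red e′)))
  red-out-injective (mid p) (mid q) (mid q′) _ _ _ _ e e′ with midMid-red e | midMid-red e′ | <-cmp q q′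
  ... | a<q , q/≡t | _ , q′/≡t | tri< q<q′ _ _ =
    contradiction (trans q/≡t (sym q′/≡t)) (<⇒≢ (red-pair-quotients-increase a<q q<q′))
  ... | _ , _ | _ , _ | tri≈ _ q≡q′ _ = cong mid q≡q′
  ... | _ , q/≡t | a<q′ , q′/≡t | tri> _ _ q′<q =
    contradiction (trans q′/≡t (sym q/≡t)) (<⇒≢ (red-pair-quotients-increase a<q′ q′<q))
  red-out-injective (mid p) (mid q) (high t′) p<q _ q≤k _ e e′ = ⊥-elim (midMid-midHigh-red-clash p<q q≤k e e′)
  red-out-injective (mid p) (high t′) (mid q) _ p<q _ q≤k e e′ = ⊥-elim (midMid-midHigh-red-clash p<q q≤k e′ e)
  red-out-injective (mid p) (high t₁) (high t₂) _ _ _ _ e e′ =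
    cong high (trans (sym (proj₁ (midHigh-red e))) (proj₁ (midHigh-red e′)))
  red-out-injective (high _) (high _) (high _) _ _ _ _ refl refl = refl

  blue-in-injective : ∀ u u′ w {t} → u ⋖ w → u′ ⋖ w → colour u w ≡ blue t → colour u′ w ≡ blue t → u ≡ u′
  blue-in-injective (low b) (low b′) (low _) _ _ refl refl = refl
  blue-in-injective (low b) (low b′) (mid x) _ _ e e′ =
    cong low (trans (sym (proj₁ (lowMid-blue e))) (proj₁ (lowMid-blue e′)))
  blue-in-injective (low b) (mid p) (mid x) _ p<x e e′ = ⊥-elim (lowMid-midMid-blue-clash p<x e e′)
  blue-in-injective (mid p) (low b) (mid x) p<x _ e e′ = ⊥-elim (lowMid-midMid-blue-clash p<x e′ e)
  blue-in-injective (mid p) (mid p′) (mid x) p<x p′<x e e′ with midMid-blue e | midMid-blue e′ | <-cmp p p′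
  ... | x≤a , p%≡t | _ , p′%≡t | tri< p<p′ _ _ =
    contradiction (trans p%≡t (sym p′%≡t)) (blue-pair-residues-distinct x≤a p<p′ p′<x)
  ... | _ , _ | _ , _ | tri≈ _ p≡p′ _ = cong mid p≡p′
  ... | x≤a , p%≡t | _ , p′%≡t | tri> _ _ p′<p =
    contradiction (trans p′%≡t (sym p%≡t)) (blue-pair-residues-distinct x≤a p′<p p<x)
  blue-in-injective (low b) (low b′) (high t) _ _ e e′ =
    cong low (trans (sym (proj₁ (lowHigh-blue e))) (proj₁ (lowHigh-blue e′)))
  blue-in-injective (low b) (mid x) (high t) _ _ e e′ = ⊥-elim (lowHigh-midHigh-blue-clash e e′)
  blue-in-injective (mid x) (low b) (high t) _ _ e e′ = ⊥-elim (lowHigh-midHigh-blue-clash e′ e)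
  blue-in-injective (mid x) (mid x′) (high t) _ _ e e′ with midHigh-blue e | midHigh-blue e′
  ... | q , _ , _ , x<q , q/≡t , q%≡u | q′ , _ , _ , x′<q′ , q′/≡t , q′%≡u =
    cong mid (proj₁ (pairIndex-injective x<q x′<q′
      (divmod-injective a (trans q%≡u (sym q′%≡u)) (trans q/≡t (sym q′/≡t)))))

  red-label< : ∀ u w {t} → u ⋖ w → Valid w → colour u w ≡ red t → t < c
  red-label< (low b) (mid x) _ x≤k e with lowMid-red e
  ... | p , p<x , _ , _ , refl = mid-pair-quotient< p<x x≤k
  red-label< (low b) (high t′) _ t′<c e with lowHigh-red e
  ... | refl , _ = t′<c
  red-label< (mid p) (mid q) p<q q≤k e with midMid-red e
  ... | _ , refl = mid-pair-quotient< p<q q≤k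
  red-label< (mid p) (high t′) _ t′<c e with midHigh-red e
  ... | refl , _ = t′<c
  red-label< (high _) (high t′) _ t′<c refl = t′<c

  blue-label< : ∀ u w {t} → u ⋖ w → Valid u → colour u w ≡ blue t → t < a
  blue-label< (low b) (low _) _ b<a refl = b<a
  blue-label< (low b) (mid x) _ b<a e with lowMid-blue e
  ... | refl , _ = b<a
  blue-label< (low b) (high t) _ b<a e with lowHigh-blue e
  ... | refl , _ = b<a
  blue-label< (mid p) (mid q) _ _ e with midMid-blue e
  ... | _ , refl = m%n<n _ a
  blue-label< (mid p) (high t) _ _ e with midHigh-blue e
  ... | q , _ , _ , _ , _ , refl = m%n<n _ a

  chainLength : ℕ
  chainLength = a + suc k + c

  data Position : ℕ → Set where
    at-low  : ∀ b → b < a → Position b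
    at-mid  : ∀ x → x ≤ k → Position (a + x)
    at-high : ∀ t → Position (a + suc k + t)

  position : ∀ i → Position i
  position i with i <? a
  ... | yes i<a = at-low i i<a
  ... | no i≮a with i ∸ a ≤? k
  ...   | yes i-a≤k = subst Position (m+[n∸m]≡n (≮⇒≥ i≮a)) (at-mid (i ∸ a) i-a≤k)
  ...   | no  i-a≰k = subst Position (m+[n∸m]≡n past-mid) (at-high (i ∸ (a + suc k)))
    where
    past-mid : a + suc k ≤ i
    past-mid = subst (a + suc k ≤_) (m+[n∸m]≡n (≮⇒≥ i≮a)) (+-monoʳ-≤ a (≰⇒> i-a≰k))

  vertexAt : ∀ {i} → Position i → Vertex
  vertexAt (at-low b _) = low b
  vertexAt (at-mid x _) = mid x
  vertexAt (at-high t)  = high t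

  vertexAt-injective : ∀ {i j} (P : Position i) (Q : Position j) → vertexAt P ≡ vertexAt Q → i ≡ j
  vertexAt-injective (at-low _ _) (at-low _ _) refl = refl
  vertexAt-injective (at-mid _ _) (at-mid _ _) refl = refl
  vertexAt-injective (at-high _)  (at-high _)  refl = refl

  vertexAt-⋖ : ∀ {i j} (P : Position i) (Q : Position j) → i < j → vertexAt P ⋖ vertexAt Q
  vertexAt-⋖ (at-low _ _)   (at-low _ _)   b<b′ = b<b′
  vertexAt-⋖ (at-low _ _)   (at-mid _ _)   _    = tt
  vertexAt-⋖ (at-low _ _)   (at-high _)    _    = tt
  vertexAt-⋖ (at-mid x _)   (at-low _ b<a) x<b  = <⇒≱ (<-trans x<b b<a) (m≤m+n a x)
  vertexAt-⋖ (at-mid x _)   (at-mid _ _)   x<q  = +-cancelˡ-< a _ _ x<q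
  vertexAt-⋖ (at-mid _ _)   (at-high _)    _    = tt
  vertexAt-⋖ (at-high t)    (at-low _ b<a) t<b  = <⇒≱ (<-trans t<b b<a) (≤-trans (m≤m+n a (suc k)) (m≤m+n _ t))
  vertexAt-⋖ (at-high t)    (at-mid x x≤k) t<x  =
    <⇒≱ (+-cancelˡ-< a _ _ (subst (_< a + x) (+-assoc a (suc k) t) t<x)) (≤-trans x≤k (≤-trans (n≤1+n k) (m≤m+n (suc k) t)))
  vertexAt-⋖ (at-high _)    (at-high _)    t<t′ = +-cancelˡ-< (a + suc k) _ _ t<t′

  vertexAt-valid : ∀ {i} (P : Position i) → i < chainLength → Valid (vertexAt P)
  vertexAt-valid (at-low _ b<a) _ = b<a
  vertexAt-valid (at-mid _ x≤k) _ = x≤k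
  vertexAt-valid (at-high t)    i<len = +-cancelˡ-< (a + suc k) t c i<len

  vertex : ℕ → Vertex
  vertex i = vertexAt (position i)

  χ : ℕ → ℕ → Label
  χ i j = colour (vertex i) (vertex j)

  χ-red-out-injective : ∀ {i j j′ t} → i < j → i < j′ → j < chainLength → j′ < chainLength →
                        χ i j ≡ red t → χ i j′ ≡ red t → j ≡ j′
  χ-red-out-injective {i} {j} {j′} i<j i<j′ j<len j′<len e e′ =
    vertexAt-injective (position j) (position j′)
      (red-out-injective (vertex i) (vertex j) (vertex j′)
        (vertexAt-⋖ (position i) (position j) i<j) (vertexAt-⋖ (position i) (position j′) i<j′)
        (vertexAt-valid (position j) j<len) (vertexAt-valid (position j′) j′<len) e e′)

  χ-blue-in-injective : ∀ {i i′ j t} → i < j → i′ < j → χ i j ≡ blue t → χ i′ j ≡ blue t → i ≡ i′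
  χ-blue-in-injective {i} {i′} {j} i<j i′<j e e′ =
    vertexAt-injective (position i) (position i′)
      (blue-in-injective (vertex i) (vertex i′) (vertex j)
        (vertexAt-⋖ (position i) (position j) i<j) (vertexAt-⋖ (position i′) (position j) i′<j) e e′)

  χ-red-label< : ∀ {i j t} → i < j → j < chainLength → χ i j ≡ red t → t < c
  χ-red-label< {i} {j} i<j j<len =
    red-label< (vertex i) (vertex j) (vertexAt-⋖ (position i) (position j) i<j) (vertexAt-valid (position j) j<len)

  χ-blue-label< : ∀ {i j t} → i < j → j < chainLength → χ i j ≡ blue t → t < a
  χ-blue-label< {i} {j} i<j j<len =
    blue-label< (vertex i) (vertex j) (vertexAt-⋖ (position i) (position j) i<j) (vertexAt-valid (position i) (<-trans i<j j<len))

bounded-injection⇒≤ : ∀ {m n} (f : Fin m → ℕ) → (∀ i → f i < n) → Injective _≡_ _≡_ f → m ≤ n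
bounded-injection⇒≤ f f< f-inj = FinP.injective⇒≤ {f = λ i → F.fromℕ< (f< i)}
  λ {i} {j} same → f-inj (trans (sym (FinP.toℕ-fromℕ< (f< i))) (trans (cong toℕ same) (FinP.toℕ-fromℕ< (f< j))))

-- Mixed-radix reading of a grid point, least significant coordinate first: a linear extension of ≼.
rank : ∀ {ℓ d} → Grid ℓ d → ℕ
rank []          = 0
rank {ℓ} (x ∷ v) = toℕ x + ℓ * rank v

rank< : ∀ {ℓ d} (v : Grid ℓ d) → rank v < ℓ ^ d
rank< []          = s≤s z≤n
rank< {ℓ} {suc d} (x ∷ v) = begin-strict
  toℕ x + ℓ * rank v <⟨ +-monoˡ-< _ (FinP.toℕ<n x) ⟩
  ℓ + ℓ * rank v     ≡⟨ *-suc ℓ (rank v) ⟨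
  ℓ * suc (rank v)   ≤⟨ *-monoʳ-≤ ℓ (rank< v) ⟩
  ℓ * ℓ ^ d          ∎
  where open ≤-Reasoning

digit-carry : ∀ {ℓ u u′ e e′} → u < ℓ → e < e′ → u + ℓ * e < u′ + ℓ * e′
digit-carry {ℓ} {u} {u′} {e} {e′} u<ℓ e<e′ = begin-strict
  u + ℓ * e  <⟨ +-monoˡ-< _ u<ℓ ⟩
  ℓ + ℓ * e  ≡⟨ *-suc ℓ e ⟨
  ℓ * suc e  ≤⟨ *-monoʳ-≤ ℓ e<e′ ⟩
  ℓ * e′     ≤⟨ m≤n+m _ u′ ⟩
  u′ + ℓ * e′ ∎
  where open ≤-Reasoning

rank-injective : ∀ {ℓ d} (v w : Grid ℓ d) → rank v ≡ rank w → v ≡ w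
rank-injective []      []      _    = refl
rank-injective {ℓ} (x ∷ v) (y ∷ w) same with <-cmp (rank v) (rank w)
... | tri< v<w _ _ = contradiction same (<⇒≢ (digit-carry (FinP.toℕ<n x) v<w))
... | tri> _ _ w<v = contradiction (sym same) (<⇒≢ (digit-carry (FinP.toℕ<n y) w<v))
... | tri≈ _ v≡w _ with rank-injective v w v≡w
...   | refl = cong (_∷ w) (FinP.toℕ-injective (+-cancelʳ-≡ (ℓ * rank v) (toℕ x) (toℕ y) same))

rank-mono-≤ : ∀ {ℓ d} (v w : Grid ℓ d) → v ≼ w → rank v ≤ rank w
rank-mono-≤ []      []      _   = z≤n
rank-mono-≤ {ℓ} (x ∷ v) (y ∷ w) v≼w = +-mono-≤ (v≼w zero) (*-monoʳ-≤ ℓ (rank-mono-≤ v w (v≼w ∘ suc)))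

rank-mono-< : ∀ {ℓ d} (v w : Grid ℓ d) → v ≼ w → v ≢ w → rank v < rank w
rank-mono-< v w v≼w v≢w = ≤∧≢⇒< (rank-mono-≤ v w v≼w) (v≢w ∘ rank-injective v w)

toColour : Label → Fin 2
toColour (red _)  = zero
toColour (blue _) = suc zero

toColour-red : ∀ l → toColour l ≡ zero → ∃ λ t → l ≡ red t
toColour-red (red t) _ = t , refl

toColour-blue : ∀ l → toColour l ≡ suc zero → ∃ λ t → l ≡ blue t
toColour-blue (blue t) _ = t , refl

module PulledBack (a c k : ℕ) .{{_ : NonZero a}} (room : k * (k + 1) ≤ 2 * (c * a)) {ℓ d : ℕ}
                  (small : ℓ ^ d ≤ ChainColouring.chainLength a c k room) where

  open ChainColouring a c k room

  pulled : Colouring ℓ d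
  pulled v w = toColour (χ (rank v) (rank w))

  private
    rank<chainLength : (v : Grid ℓ d) → rank v < chainLength
    rank<chainLength v = <-≤-trans (rank< v) small

  no-red-cup : ¬ CupCopy pulled zero (suc c)
  no-red-cup (x , y , y-inj , edge) = contradiction (bounded-injection⇒≤ label label< label-inj) (n≮n c)
    where
    x<y : ∀ i → rank x < rank (y i)
    x<y i = let x≢y , x≼y , _ = edge i in rank-mono-< x (y i) x≼y x≢y
    redEdge : ∀ i → ∃ λ t → χ (rank x) (rank (y i)) ≡ red t
    redEdge i = toColour-red _ (proj₂ (proj₂ (edge i)))
    label : Fin (suc c) → ℕ
    label = proj₁ ∘ redEdge
    label< : ∀ i → label i < c
    label< i = χ-red-label< (x<y i) (rank<chainLength (y i)) (proj₂ (redEdge i))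
    label-inj : Injective _≡_ _≡_ label
    label-inj {i} {j} same = y-inj (rank-injective (y i) (y j)
      (χ-red-out-injective (x<y i) (x<y j) (rank<chainLength (y i)) (rank<chainLength (y j))
        (proj₂ (redEdge i)) (trans (proj₂ (redEdge j)) (cong red (sym same)))))

  no-blue-cap : ¬ CapCopy pulled (suc zero) (suc a)
  no-blue-cap (y , x , x-inj , edge) = contradiction (bounded-injection⇒≤ label label< label-inj) (n≮n a)
    where
    x<y : ∀ i → rank (x i) < rank y
    x<y i = let x≢y , x≼y , _ = edge i in rank-mono-< (x i) y x≼y x≢y
    blueEdge : ∀ i → ∃ λ t → χ (rank (x i)) (rank y) ≡ blue t
    blueEdge i = toColour-blue _ (proj₂ (proj₂ (edge i)))
    label : Fin (suc a) → ℕ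
    label = proj₁ ∘ blueEdge
    label< : ∀ i → label i < a
    label< i = χ-blue-label< (x<y i) (rank<chainLength y) (proj₂ (blueEdge i))
    label-inj : Injective _≡_ _≡_ label
    label-inj {i} {j} same = x-inj (rank-injective (x i) (x j)
      (χ-blue-in-injective (x<y i) (x<y j)
        (proj₂ (blueEdge i)) (trans (proj₂ (blueEdge j)) (cong blue (sym same)))))

arrows⇒lower-bound : ∀ {ℓ d r s k} → 2 ≤ r → 2 ≤ s → k * (k + 1) ≤ 2 * ((r ∸ 1) * (s ∸ 1)) →
                     Arrows ℓ d r s → k + r + s ≤ ℓ ^ d
arrows⇒lower-bound {ℓ} {d} {suc c@(suc _)} {suc a@(suc _)} {k} (s≤s (s≤s z≤n)) (s≤s (s≤s z≤n)) room arrows =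
  ≮⇒≥ λ ℓ^d<k+r+s →
    let small = s≤s⁻¹ (subst (ℓ ^ d <_) (count k c a) ℓ^d<k+r+s)
        open PulledBack a c k room {ℓ} {d} small
    in case arrows pulled of λ
         { (inj₁ cup) → no-red-cup cup
         ; (inj₂ cap) → no-blue-cap cap }
  where
  count : ∀ k c a → k + suc c + suc a ≡ suc (a + suc k + c)
  count = solve-∀

least-positive : {P : ℕ → Set} → (∀ n → Dec (P n)) → ∀ {K} → 1 ≤ K → P K → ∃ (IsPR P)
least-positive {P} P? {K} 1≤K pK with search K
  where
  search : ∀ b → ∃ (IsPR P) ⊎ (∀ M → 1 ≤ M → M ≤ b → ¬ P M)
  search zero = inj₂ λ { M 1≤M z≤n → contradiction 1≤M λ () }
  search (suc b) with search b | P? (suc b)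
  ... | inj₁ found | _      = inj₁ found
  ... | inj₂ none  | yes p  = inj₁ (suc b , s≤s z≤n , p , λ M 1≤M M≤b → none M 1≤M (s≤s⁻¹ M≤b))
  ... | inj₂ none  | no ¬p  = inj₂ λ M 1≤M M≤1+b → case M ≟ suc b of λ
    { (yes refl)  → ¬p
    ; (no M≢1+b) → none M 1≤M (s≤s⁻¹ (≤∧≢⇒< M≤1+b M≢1+b)) }
... | inj₁ found = found
... | inj₂ none  = contradiction pK (none K 1≤K ≤-refl)

IsPR-minimal : ∀ {P : ℕ → Set} {N K} → IsPR P N → 1 ≤ K → P K → N ≤ K
IsPR-minimal (_ , _ , minimal) 1≤K pK = ≮⇒≥ λ K<N → minimal _ 1≤K K<N pK

n*2^n≤3^n : ∀ n → n * 2 ^ n ≤ 3 ^ n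
n*2^n≤3^n zero          = z≤n
n*2^n≤3^n (suc zero)    = toWitness {a? = 2 ≤? 3} _
n*2^n≤3^n (suc (suc n)) = from-two n
  where
  from-two : ∀ n → (2 + n) * 2 ^ (2 + n) ≤ 3 ^ (2 + n)
  from-two zero    = toWitness {a? = 8 ≤? 9} _
  from-two (suc n) = begin
    (3 + n) * 2 ^ (3 + n)                     ≡⟨ split n (2 ^ n) ⟩
    2 * ((2 + n) * 2 ^ (2 + n)) + 8 * 2 ^ n   ≤⟨ +-mono-≤ (*-monoʳ-≤ 2 (from-two n))
                                                           (*-mono-≤ (toWitness {a? = 8 ≤? 9} _) (^-monoˡ-≤ n (n≤1+n 2))) ⟩
    2 * 3 ^ (2 + n) + 9 * 3 ^ n               ≡⟨ merge (3 ^ n) ⟩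
    3 ^ (3 + n)                               ∎
    where
    open ≤-Reasoning
    split : ∀ n x → (3 + n) * (2 * (2 * (2 * x))) ≡ 2 * ((2 + n) * (2 * (2 * x))) + 8 * x
    split = solve-∀
    merge : ∀ y → 2 * (3 * (3 * y)) + 9 * y ≡ 3 * (3 * (3 * y))
    merge = solve-∀

2≤r+s∸1 : ∀ {r s} → 2 ≤ r → 1 ≤ s → 2 ≤ r + s ∸ 1
2≤r+s∸1 {r} {s} 2≤r 1≤s = ≤-trans 2≤r (≤-trans (m≤m+n r (s ∸ 1)) (≤-reflexive (sym (+-∸-assoc r 1≤s))))

PR-𝒬-bounds : ∀ {ℓ r s k} → 2 ≤ ℓ → 2 ≤ r → 2 ≤ s → k * (k + 1) ≤ 2 * ((r ∸ 1) * (s ∸ 1)) →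
              Σ ℕ λ N → IsPR (λ n → Arrows ℓ n r s) N
                × (k + r + s ≤ ℓ ^ N)
                × ((K : ℕ) → (r + s ∸ 1) * 2 ^ K ≤ suc ℓ ^ K → N ≤ K)
PR-𝒬-bounds {ℓ} {r} {s} 2≤ℓ 2≤r 2≤s room =
  let N , isPR = least-positive (λ n → arrows-dec ℓ n r s) (≤-trans (n≤1+n 1) 2≤X)
                   (arrows-by-counting X r s 1≤ℓ 2≤r 1≤s (≤-trans (n*2^n≤3^n X) (^-monoˡ-≤ X (s≤s 2≤ℓ))))
  in N , isPR , arrows⇒lower-bound 2≤r 2≤s room (proj₁ (proj₂ isPR)) , upper isPR
  where
  X = r + s ∸ 1
  1≤ℓ = ≤-trans (n≤1+n 1) 2≤ℓ
  1≤s = ≤-trans (n≤1+n 1) 2≤s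
  2≤X = 2≤r+s∸1 2≤r 1≤s
  upper : ∀ {N} → IsPR (λ n → Arrows ℓ n r s) N → ∀ K → X * 2 ^ K ≤ suc ℓ ^ K → N ≤ K
  upper _    zero    X≤1   = contradiction (≤-trans 2≤X (≤-trans (≤-reflexive (sym (*-identityʳ X))) X≤1)) λ { (s≤s ()) }
  upper isPR (suc K) small = IsPR-minimal isPR (s≤s z≤n) (arrows-by-counting (suc K) r s 1≤ℓ 2≤r 1≤s small)

PR-ℋ-bounds : ∀ {m r s k} → 1 ≤ m → 2 ≤ r → 2 ≤ s → k * (k + 1) ≤ 2 * ((r ∸ 1) * (s ∸ 1)) →
              Σ ℕ λ N → IsPR (λ n → Arrows n m r s) N
                × (k + r + s ≤ N ^ m)
                × (N ^ m < 2 ^ m * (r + s ∸ 1))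
PR-ℋ-bounds {m} {r} {s} 1≤m 2≤r 2≤s room =
  let N , isPR = least-positive (λ n → arrows-dec n m r s) 1≤K (arrows-by-counting m r s 1≤K 2≤r 1≤s K≤[1+K]^m)
  in N , isPR , arrows⇒lower-bound 2≤r 2≤s room (proj₁ (proj₂ isPR)) , upper N isPR
  where
  X = r + s ∸ 1
  1≤s = ≤-trans (n≤1+n 1) 2≤s
  2≤X = 2≤r+s∸1 2≤r 1≤s
  K = X * 2 ^ m
  1≤K : 1 ≤ K
  1≤K = *-mono-≤ (≤-trans (n≤1+n 1) 2≤X) (m^n>0 2 m)
  K≤[1+K]^m : K ≤ suc K ^ m
  K≤[1+K]^m = ≤-trans (n≤1+n K) (≤-trans (≤-reflexive (sym (^-identityʳ (suc K)))) (^-monoʳ-≤ (suc K) 1≤m))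
  upper : ∀ N → IsPR (λ n → Arrows n m r s) N → N ^ m < 2 ^ m * X
  upper (suc zero)    _ = subst (_< 2 ^ m * X) (sym (^-zeroˡ m)) (<-≤-trans 2≤X (m≤n*m X (2 ^ m) {{m^n≢0 2 m}}))
  upper (suc (suc N)) (_ , _ , minimal) = ≰⇒> λ 2^mX≤ →
    minimal (suc N) (s≤s z≤n) ≤-refl
      (arrows-by-counting m r s (s≤s z≤n) 2≤r 1≤s (subst (_≤ suc (suc N) ^ m) (*-comm (2 ^ m) X) 2^mX≤))

theorem5p2 : (ℓ m r s k : ℕ) → 2 ≤ ℓ → 1 ≤ m → 2 ≤ r → 2 ≤ s →
    k * (k + 1) ≤ 2 * ((r ∸ 1) * (s ∸ 1)) →
    2 * ((r ∸ 1) * (s ∸ 1)) < (k + 1) * (k + 2) →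
    (Σ ℕ λ N → IsPR (λ n → Arrows ℓ n r s) N
    × (k + r + s ≤ ℓ ^ N)
    × ((K : ℕ) → (r + s ∸ 1) * 2 ^ K ≤ suc ℓ ^ K → N ≤ K))
    × (Σ ℕ λ N → IsPR (λ n → Arrows n m r s) N
    × (k + r + s ≤ N ^ m)
    × (N ^ m < 2 ^ m * (r + s ∸ 1)))
theorem5p2 ℓ m r s k 2≤ℓ 1≤m 2≤r 2≤s room _ =
  PR-𝒬-bounds 2≤ℓ 2≤r 2≤s room , PR-ℋ-bounds 1≤m 2≤r 2≤s room
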